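{- Let $em:Q\hookrightarrow B^d$ be a sculpture. Then for every rooted path $\pi$ in $Q$ ending at a cell $q$, one has $\mathcal U(em)(S_\pi)=\{i:em(q)_i\ne0\}$ and $\mathcal U(em)(T_\pi)=\{i:em(q)_i=1\}$; i.e. the quotient of $(S_\pi,T_\pi)$ by $\equiv_{em}$ is the ST-configuration corresponding to $em(q)$.
   Context: Precubical sets: families of disjoint sets $Q_n$ with face maps $s_k,t_k:Q_n\to Q_{n-1}$ ($k=1,\dots,n$) satisfying $\alpha_k\beta_\ell=\beta_{\ell-1}\alpha_k$ for $\alpha,\beta\in\{s,t\}$, $k<\ell$. An HDA is a finite precubical set with initial cell $I\in Q_0$; HDA morphisms commute with face maps and preserve initial cells; embeddings are injective. The bulk $B^d$ has $n$-cells the tuples in $\{0,\ast,1\}^d$ with exactly $n$ entries $\ast$; $s_k$ (resp. $t_k$) replaces the $k$-th $\ast$ by $0$ (resp. $1$); initial cell $(0,\dots,0)$. A sculpture is an HDA embedding $em:Q\hookrightarrow B^d$. Steps: $q'\xrightarrow{s_i}q$ with $s_iq=q'$, $q\xrightarrow{t_i}q'$ with $t_iq=q'$; rooted paths start at $I$. Universal labels: $\approx$ is the equivalence on $Q_1$ generated by $(s_iq,t_iq)$, $q\in Q_2$, $i\in\{1,2\}$; $\mathcal U(Q)=Q_1/\approx$, $\lambda(e)$ the class of $e$; $\lambda_i(q)=\lambda(s_1\cdots s_{i-1}s_{i+1}\cdots s_n(q))$. For a rooted path $\pi$: trivial path gives $(\emptyset,\emptyset)$; $\pi=\pi'\xrightarrow{s_i}q$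 gives $S_\pi=S_{\pi'}\cup\{\lambda_i(q)\}$, $T_\pi=T_{\pi'}$; $\pi=\pi'\xrightarrow{t_i}t_i(q')$ with $q'$ the end of $\pi'$ gives $S_\pi=S_{\pi'}$, $T_\pi=T_{\pi'}\cup\{\lambda_i(q')\}$. The map $\mathcal U(em):\mathcal U(Q)\to\{1,\dots,d\}$ sends $\lambda(e)$ to the unique index $k$ with $em(e)_k=\ast$ (this is well defined); $a\equiv_{em}b$ iff $\mathcal U(em)(a)=\mathcal U(em)(b)$. -}

module Defs where

open import Data.Nat using (ℕ; zero; suc; _≤_; _<_; z≤n; s≤s)
open import Data.Nat.Properties using (suc-injective; ≡-irrelevant)
open import Data.Fin using (Fin; toℕ; inject₁; fromℕ)
open import Data.Fin.Properties using (toℕ<n)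
import Data.Fin as F
open import Data.Bool using (Bool; true; false)
open import Data.Vec using (Vec; []; _∷_; replicate; lookup)
open import Data.List using (List; []; _∷_)
open import Data.List.Membership.Propositional using (_∈_)
open import Data.Maybe using (Maybe; just; nothing)
import Data.Maybe as M
open import Data.Product using (Σ; ∃; _×_; _,_; proj₁; proj₂)
open import Data.Empty using (⊥)
open import Function.Definitions using (Injective; Surjective)
open import Relation.Binary.PropositionalEquality
  using (_≡_; refl; sym; trans; cong; cong₂)

-- Cells of dimension n form the set  Cell n  (the
-- family is indexed by ℕ, hence the sets are disjoint).  Face maps are
-- indexed by a Bool (false = s, true = t) and a 0-based index:
-- face α n i : Cell (suc n) → Cell n  is  α_{i+1}  of the paper.

record PrecubicalSet : Set₁ where
  field
    Cell : ℕ → Set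
    face : Bool → (n : ℕ) → Fin (suc n) → Cell (suc n) → Cell n
    -- α_k β_ℓ = β_{ℓ-1} α_k  for k < ℓ  (paper indices 1-based:
    -- k = toℕ k' + 1, ℓ = toℕ ℓ' + 2, so k < ℓ  iff  k' ≤ ℓ')
    cubical : ∀ (α β : Bool) (n : ℕ) (k ℓ : Fin (suc n))
              (x : Cell (suc (suc n))) → toℕ k ≤ toℕ ℓ →
              face α n k (face β (suc n) (F.suc ℓ) x)
                ≡ face β n ℓ (face α (suc n) (inject₁ k) x)

  s t : (n : ℕ) → Fin (suc n) → Cell (suc n) → Cell n
  s = face false
  t = face true

open PrecubicalSet

IsFinite : PrecubicalSet → Set
IsFinite P =
  (∃ λ N → ∀ n → N ≤ n → Cell P n → ⊥) ×
  (∀ n → ∃ λ m → Σ (Fin m → Cell P n) λ f → Surjective _≡_ _≡_ f)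

record HDA : Set₁ where
  field
    precub  : PrecubicalSet
    initial : Cell precub 0
    finite  : IsFinite precub

open HDA

record Morphism (P P' : PrecubicalSet) (i : Cell P 0) (i' : Cell P' 0) : Set where
  field
    map      : ∀ n → Cell P n → Cell P' n
    map-face : ∀ α n k (q : Cell P (suc n)) →
               map n (face P α n k q) ≡ face P' α n k (map (suc n) q)
    map-init : map 0 i ≡ i'

record Embedding (P P' : PrecubicalSet) (i : Cell P 0) (i' : Cell P' 0) : Set where
  field
    mor : Morphism P P' i i'
    inj : ∀ n → Injective _≡_ _≡_ (Morphism.map mor n)

data Tri : Set where
  t0 t⋆ t1 : Tri

stars : ∀ {d} → Vec Tri d → ℕ
stars []         = 0
stars (t0 ∷ v)   = stars v
stars (t⋆ ∷ v)   = suc (stars v)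
stars (t1 ∷ v)   = stars v

val : Bool → Tri
val false = t0
val true  = t1

-- replace the k-th (0-based) entry ⋆ by val b
rep : ∀ {d} → Bool → ℕ → Vec Tri d → Vec Tri d
rep b k       []         = []
rep b k       (t0 ∷ v)   = t0 ∷ rep b k v
rep b zero    (t⋆ ∷ v)   = val b ∷ v
rep b (suc k) (t⋆ ∷ v)   = t⋆ ∷ rep b k v
rep b k       (t1 ∷ v)   = t1 ∷ rep b k v

BCell : ℕ → ℕ → Set
BCell d n = Σ (Vec Tri d) λ v → stars v ≡ n

private
  stars-val : ∀ {d} b (v : Vec Tri d) → stars (val b ∷ v) ≡ stars v
  stars-val false v = refl
  stars-val true  v = refl

  rep-val : ∀ {d} a b k (v : Vec Tri d) → rep a k (val b ∷ v) ≡ val b ∷ rep a k v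
  rep-val a false k v = refl
  rep-val a true  k v = refl

  rep-stars : ∀ {d} b (v : Vec Tri d) k n → stars v ≡ suc n → k < suc n →
              stars (rep b k v) ≡ n
  rep-stars b []       k       n       () _
  rep-stars b (t0 ∷ v) k       n       e  l = rep-stars b v k n e l
  rep-stars b (t1 ∷ v) k       n       e  l = rep-stars b v k n e l
  rep-stars b (t⋆ ∷ v) zero    n       e  l = trans (stars-val b v) (suc-injective e)
  rep-stars b (t⋆ ∷ v) (suc k) (suc n) e (s≤s l) =
    cong suc (rep-stars b v k n (suc-injective e) l)

  rep-comm : ∀ {d} a b (v : Vec Tri d) k ℓ → k ≤ ℓ →
             rep a k (rep b (suc ℓ) v) ≡ rep b ℓ (rep a k v)
  rep-comm a b []       k       ℓ       l = refl
  rep-comm a b (t0 ∷ v) k       ℓ       l = cong (t0 ∷_) (rep-comm a b v k ℓ l)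
  rep-comm a b (t1 ∷ v) k       ℓ       l = cong (t1 ∷_) (rep-comm a b v k ℓ l)
  rep-comm a b (t⋆ ∷ v) zero    ℓ       l = sym (rep-val b a ℓ v)
  rep-comm a b (t⋆ ∷ v) (suc k) (suc ℓ) (s≤s l) = cong (t⋆ ∷_) (rep-comm a b v k ℓ l)

bface : ∀ d → Bool → (n : ℕ) → Fin (suc n) → BCell d (suc n) → BCell d n
bface d b n i (v , e) = rep b (toℕ i) v , rep-stars b v (toℕ i) n e (toℕ<n i)

private
  Σ≡ : ∀ {d n} {x y : BCell d n} → proj₁ x ≡ proj₁ y → x ≡ y
  Σ≡ {x = v , e} {y = .v , e'} refl = cong (v ,_) (≡-irrelevant e e')

  toℕ-inject₁ : ∀ {n} (k : Fin n) → toℕ (inject₁ k) ≡ toℕ k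
  toℕ-inject₁ F.zero    = refl
  toℕ-inject₁ (F.suc k) = cong suc (toℕ-inject₁ k)

  bcubical : ∀ d (α β : Bool) (n : ℕ) (k ℓ : Fin (suc n))
             (x : BCell d (suc (suc n))) → toℕ k ≤ toℕ ℓ →
             bface d α n k (bface d β (suc n) (F.suc ℓ) x)
               ≡ bface d β n ℓ (bface d α (suc n) (inject₁ k) x)
  bcubical d α β n k ℓ (v , e) l =
    Σ≡ (trans (rep-comm α β v (toℕ k) (toℕ ℓ) l)
              (cong (λ m → rep β (toℕ ℓ) (rep α m v)) (sym (toℕ-inject₁ k))))

Bulk : ℕ → PrecubicalSet
Bulk d = record { Cell = BCell d ; face = bface d ; cubical = bcubical d }

bulkInit : ∀ d → BCell d 0
bulkInit d = replicate d t0 , zeros d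
  where
  zeros : ∀ m → stars (replicate m t0) ≡ 0
  zeros zero    = refl
  zeros (suc m) = zeros m

Sculpture : HDA → ℕ → Set
Sculpture Q d = Embedding (precub Q) (Bulk d) (initial Q) (bulkInit d)

emVec : ∀ {Q : HDA} {d} → Sculpture Q d → ∀ n → Cell (precub Q) n → Vec Tri d
emVec em n q = proj₁ (Morphism.map (Embedding.mor em) n q)

module _ (Q : HDA) where
  private
    P = precub Q
    C = Cell P

  data RootedPath : (n : ℕ) → C n → Set where
    start : RootedPath 0 (initial Q)
    up    : ∀ {n} {q : C (suc n)} (i : Fin (suc n)) →
            RootedPath n (s P n i q) → RootedPath (suc n) q
    down  : ∀ {n} {q : C (suc n)} (i : Fin (suc n)) →
            RootedPath (suc n) q → RootedPath n (t P n i q)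

  data _≈_ : C 1 → C 1 → Set where
    gen    : (q : C 2) (i : Fin 2) → s P 1 i q ≈ t P 1 i q
    ≈refl  : ∀ {e} → e ≈ e
    ≈sym   : ∀ {e f} → e ≈ f → f ≈ e
    ≈trans : ∀ {e f g} → e ≈ f → f ≈ g → e ≈ g

  -- s_1 ⋯ s_j applied to a cell of dimension j+1 (s_j applied first)
  lowS : (j : ℕ) → C (suc j) → C 1
  lowS zero    q = q
  lowS (suc j) q = lowS j (s P (suc j) (inject₁ (fromℕ j)) q)

  notLast : ∀ {n} → Fin (suc n) → Maybe (Fin n)
  notLast {zero}  F.zero    = nothing
  notLast {suc n} F.zero    = just F.zero
  notLast {suc n} (F.suc i) = M.map F.suc (notLast i)

  -- representative edge of λ_{i+1}(q) : s_1⋯s_i s_{i+2}⋯s_{n+1}(q)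
  -- for q of dimension n+1 (rightmost face applied first)
  edge : (n : ℕ) → Fin (suc n) → C (suc n) → C 1
  edge zero    i q = q
  edge (suc n) i q with notLast i
  ... | nothing = lowS (suc n) q
  ... | just j  = edge n j (s P (suc n) (fromℕ (suc n)) q)

  -- S_π and T_π, as lists of representative edges of their label classes
  Sπ : ∀ {n q} → RootedPath n q → List (C 1)
  Sπ start                 = []
  Sπ (up {n} {q} i p)      = edge n i q ∷ Sπ p
  Sπ (down i p)            = Sπ p

  Tπ : ∀ {n q} → RootedPath n q → List (C 1)
  Tπ start                 = []
  Tπ (up i p)              = Tπ p
  Tπ (down {n} {q} i p)    = edge n i q ∷ Tπ p

  -- k ∈ U(em)(X) for the set X of label classes represented by the list L:
  -- some class λ(f) ∈ X (f ∈ L) has a member e with em(e)_k = ⋆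
  -- (U(em)(λ(e)) is the unique index k with em(e)_k = ⋆).
  InImageU : ∀ {d} → Sculpture Q d → List (C 1) → Fin d → Set
  InImageU em L k =
    Σ (C 1) λ e → (Σ (C 1) λ f → f ∈ L × e ≈ f) × lookup (emVec {Q} em 1 e) k ≡ t⋆

module Submission where

-- Fix a coordinate k of the bulk.  Along a rooted path π the
-- k-th entry of em(end of π) starts at 0 (the initial cell is (0,…,0)); an
-- s_i-step read backwards turns a 0 into a ⋆ exactly when k is the
-- coordinate of the i-th ⋆, and a t_i-step turns that ⋆ into a 1.  The label
-- λ_i(q) added to S_π resp. T_π at such a step is the class of an edge of q
-- whose only ⋆ sits exactly at the coordinate of the i-th ⋆ of em(q), and
-- U(em) is well defined on classes because the generating pairs of ≈ have
-- their ⋆ at the same place.  So "k ∈ U(em)(S_π)" and "k ∈ U(em)(T_π)"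
-- evolve along π exactly like "entry ≠ 0" and "entry = 1"; the theorem is
-- this invariant, proved by induction on π.

open import Defs
open import Data.Nat using (ℕ; zero; suc; _≤_; _<_; s≤s)
open import Data.Nat.Properties using (≤-reflexive; suc-injective)
open import Data.Fin using (Fin; toℕ; inject₁; fromℕ)
import Data.Fin as F
open import Data.Fin.Properties using (toℕ<n; toℕ-fromℕ; toℕ-inject₁)
open import Data.Vec using (Vec; _∷_; lookup)
open import Data.Vec.Properties using (lookup-replicate)
open import Data.List using ([]; _∷_)
open import Data.List.Relation.Unary.Any using (here; there)
open import Data.Maybe using (just; nothing)
open import Data.Bool using (Bool; true; false; if_then_else_)
open import Data.Product using (_×_; _,_; proj₁; proj₂)
open import Data.Sum using (_⊎_; inj₁; inj₂)
open import Data.Empty using (⊥; ⊥-elim)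
open import Function.Bundles using (_⇔_; mk⇔; Equivalence)
import Function.Properties.Equivalence as ⇔
open import Relation.Binary.PropositionalEquality
  using (_≡_; _≢_; refl; sym; trans; cong; subst)

-- Decidable test for the entry ⋆, so that "k carries a ⋆" can be compared by ≡.
isStar : Tri → Bool
isStar t⋆ = true
isStar _  = false

isStar⇒⋆ : ∀ x → isStar x ≡ true → x ≡ t⋆
isStar⇒⋆ t⋆ _ = refl

isStar-val : ∀ b → isStar (val b) ≡ false
isStar-val false = refl
isStar-val true  = refl

-- isStarNo v i k: coordinate k of v carries the i-th (0-based) ⋆ of v.
isStarNo : ∀ {d} → Vec Tri d → ℕ → Fin d → Bool
isStarNo (t0 ∷ v) i       F.zero    = false
isStarNo (t0 ∷ v) i       (F.suc k) = isStarNo v i k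
isStarNo (t1 ∷ v) i       F.zero    = false
isStarNo (t1 ∷ v) i       (F.suc k) = isStarNo v i k
isStarNo (t⋆ ∷ v) zero    F.zero    = true
isStarNo (t⋆ ∷ v) zero    (F.suc k) = false
isStarNo (t⋆ ∷ v) (suc i) F.zero    = false
isStarNo (t⋆ ∷ v) (suc i) (F.suc k) = isStarNo v i k

isStarNo⇒⋆ : ∀ {d} (v : Vec Tri d) i k → isStarNo v i k ≡ true → lookup v k ≡ t⋆
isStarNo⇒⋆ (t0 ∷ v) i       (F.suc k) e = isStarNo⇒⋆ v i k e
isStarNo⇒⋆ (t1 ∷ v) i       (F.suc k) e = isStarNo⇒⋆ v i k e
isStarNo⇒⋆ (t⋆ ∷ v) zero    F.zero    e = refl
isStarNo⇒⋆ (t⋆ ∷ v) (suc i) (F.suc k) e = isStarNo⇒⋆ v i k e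

lookup-rep : ∀ {d} b i (v : Vec Tri d) k →
             lookup (rep b i v) k ≡ (if isStarNo v i k then val b else lookup v k)
lookup-rep b i       (t0 ∷ v) F.zero    = refl
lookup-rep b i       (t0 ∷ v) (F.suc k) = lookup-rep b i v k
lookup-rep b i       (t1 ∷ v) F.zero    = refl
lookup-rep b i       (t1 ∷ v) (F.suc k) = lookup-rep b i v k
lookup-rep b zero    (t⋆ ∷ v) F.zero    = refl
lookup-rep b zero    (t⋆ ∷ v) (F.suc k) = refl
lookup-rep b (suc i) (t⋆ ∷ v) F.zero    = refl
lookup-rep b (suc i) (t⋆ ∷ v) (F.suc k) = lookup-rep b i v k

-- Hence which coordinates carry a ⋆ after a face does not depend on the
-- kind (s or t) of the face; this is why U(em) respects ≈.
isStar-lookup-rep : ∀ {d} b i (v : Vec Tri d) k →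
  isStar (lookup (rep b i v) k) ≡ (if isStarNo v i k then false else isStar (lookup v k))
isStar-lookup-rep b i v k rewrite lookup-rep b i v k with isStarNo v i k
... | true  = isStar-val b
... | false = refl

isStarNo-rep-before : ∀ {d} a m ℓ (v : Vec Tri d) k → m ≤ ℓ →
                      isStarNo (rep a m v) ℓ k ≡ isStarNo v (suc ℓ) k
isStarNo-rep-before a m ℓ (t0 ∷ v) F.zero    le = refl
isStarNo-rep-before a m ℓ (t0 ∷ v) (F.suc k) le = isStarNo-rep-before a m ℓ v k le
isStarNo-rep-before a m ℓ (t1 ∷ v) F.zero    le = refl
isStarNo-rep-before a m ℓ (t1 ∷ v) (F.suc k) le = isStarNo-rep-before a m ℓ v k le
isStarNo-rep-before false zero ℓ (t⋆ ∷ v) F.zero    le = refl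
isStarNo-rep-before true  zero ℓ (t⋆ ∷ v) F.zero    le = refl
isStarNo-rep-before false zero ℓ (t⋆ ∷ v) (F.suc k) le = refl
isStarNo-rep-before true  zero ℓ (t⋆ ∷ v) (F.suc k) le = refl
isStarNo-rep-before a (suc m) (suc ℓ) (t⋆ ∷ v) F.zero    (s≤s le) = refl
isStarNo-rep-before a (suc m) (suc ℓ) (t⋆ ∷ v) (F.suc k) (s≤s le) =
  isStarNo-rep-before a m ℓ v k le

isStarNo-rep-after : ∀ {d} a m ℓ (v : Vec Tri d) k → ℓ < m →
                     isStarNo (rep a m v) ℓ k ≡ isStarNo v ℓ k
isStarNo-rep-after a m ℓ (t0 ∷ v) F.zero    lt = refl
isStarNo-rep-after a m ℓ (t0 ∷ v) (F.suc k) lt = isStarNo-rep-after a m ℓ v k lt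
isStarNo-rep-after a m ℓ (t1 ∷ v) F.zero    lt = refl
isStarNo-rep-after a m ℓ (t1 ∷ v) (F.suc k) lt = isStarNo-rep-after a m ℓ v k lt
isStarNo-rep-after a (suc m) zero    (t⋆ ∷ v) F.zero    lt = refl
isStarNo-rep-after a (suc m) zero    (t⋆ ∷ v) (F.suc k) lt = refl
isStarNo-rep-after a (suc m) (suc ℓ) (t⋆ ∷ v) F.zero    lt = refl
isStarNo-rep-after a (suc m) (suc ℓ) (t⋆ ∷ v) (F.suc k) (s≤s lt) =
  isStarNo-rep-after a m ℓ v k lt

no-star : ∀ {d} (v : Vec Tri d) k → stars v ≡ 0 → isStar (lookup v k) ≡ false
no-star (t0 ∷ v) F.zero    e = refl
no-star (t0 ∷ v) (F.suc k) e = no-star v k e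
no-star (t1 ∷ v) F.zero    e = refl
no-star (t1 ∷ v) (F.suc k) e = no-star v k e

single-star : ∀ {d} (v : Vec Tri d) k → stars v ≡ 1 →
              isStar (lookup v k) ≡ isStarNo v 0 k
single-star (t0 ∷ v) F.zero    e = refl
single-star (t0 ∷ v) (F.suc k) e = single-star v k e
single-star (t1 ∷ v) F.zero    e = refl
single-star (t1 ∷ v) (F.suc k) e = single-star v k e
single-star (t⋆ ∷ v) F.zero    e = refl
single-star (t⋆ ∷ v) (F.suc k) e = no-star v k (suc-injective e)

Agrees : Set → Set → Tri → Set
Agrees S T x = (S ⇔ x ≢ t0) × (T ⇔ x ≡ t1)

drop-false : ∀ {A : Set} → (false ≡ true ⊎ A) ⇔ A
drop-false = mk⇔ (λ { (inj₁ ()) ; (inj₂ a) → a }) inj₂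

agree-start : ∀ {S T : Set} {x} → (S → ⊥) → (T → ⊥) → x ≡ t0 → Agrees S T x
agree-start ¬S ¬T refl = mk⇔ (λ s → ⊥-elim (¬S s)) (λ 0≢0 → ⊥-elim (0≢0 refl))
                       , mk⇔ (λ t → ⊥-elim (¬T t)) (λ ())

agree-up : ∀ {S S′ T : Set} c x → (c ≡ true → x ≡ t⋆) →
           S′ ⇔ (c ≡ true ⊎ S) → Agrees S T (if c then t0 else x) → Agrees S′ T x
agree-up true x x⋆ S′⇔ (_ , T⇔) with x⋆ refl
... | refl = mk⇔ (λ _ ()) (λ _ → Equivalence.from S′⇔ (inj₁ refl))
           , mk⇔ (λ t → ⊥-elim (t0≢t1 (Equivalence.to T⇔ t))) (λ ())
  where t0≢t1 : t0 ≢ t1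
        t0≢t1 ()
agree-up false x x⋆ S′⇔ (S⇔ , T⇔) = ⇔.trans (⇔.trans S′⇔ drop-false) S⇔ , T⇔

agree-down : ∀ {S T T′ : Set} c x → (c ≡ true → x ≡ t⋆) →
             T′ ⇔ (c ≡ true ⊎ T) → Agrees S T x → Agrees S T′ (if c then t1 else x)
agree-down true x x⋆ T′⇔ (S⇔ , _) with x⋆ refl
... | refl = mk⇔ (λ _ ()) (λ _ → Equivalence.from S⇔ (λ ()))
           , mk⇔ (λ _ → refl) (λ _ → Equivalence.from T′⇔ (inj₁ refl))
agree-down false x x⋆ T′⇔ (S⇔ , T⇔) = S⇔ , ⇔.trans (⇔.trans T′⇔ drop-false) T⇔

module _ (Q : HDA) where

  notLast-nothing : ∀ {n} (i : Fin (suc n)) → notLast Q i ≡ nothing → toℕ i ≡ n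
  notLast-nothing {zero}  F.zero    e = refl
  notLast-nothing {suc n} (F.suc i) e with notLast Q i in eq
  ... | nothing = cong suc (notLast-nothing i eq)

  notLast-just : ∀ {n} (i : Fin (suc n)) j → notLast Q i ≡ just j → toℕ j ≡ toℕ i
  notLast-just {suc n} F.zero    .F.zero refl = refl
  notLast-just {suc n} (F.suc i) j e with notLast Q i in eq
  notLast-just {suc n} (F.suc i) .(F.suc j′) refl | just j′ =
    cong suc (notLast-just i j′ eq)

module _ {d : ℕ} (Q : HDA) (em : Sculpture Q d) where
  private
    P = HDA.precub Q
    C = PrecubicalSet.Cell P
    open Morphism (Embedding.mor em)

    ev : ∀ n → C n → Vec Tri d
    ev n q = emVec {Q} em n q

    starAt : C 1 → Fin d → Bool
    starAt e k = isStar (lookup (ev 1 e) k)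

  em-face : ∀ α n i (q : C (suc n)) k →
            lookup (ev n (PrecubicalSet.face P α n i q)) k
              ≡ (if isStarNo (ev (suc n) q) (toℕ i) k then val α else lookup (ev (suc n) q) k)
  em-face α n i q k =
    trans (cong (λ w → lookup (proj₁ w) k) (map-face α n i q))
          (lookup-rep α (toℕ i) (ev (suc n) q) k)

  lowS-star : ∀ j (q : C (suc j)) k → starAt (lowS Q j q) k ≡ isStarNo (ev (suc j) q) j k
  lowS-star zero    q k = single-star (ev 1 q) k (proj₂ (map 1 q))
  lowS-star (suc j) q k =
    trans (lowS-star j _ k)
      (trans (cong (λ w → isStarNo (proj₁ w) j k) (map-face false (suc j) m q))
             (isStarNo-rep-before false (toℕ m) j (ev (suc (suc j)) q) k m≤j))
    where
    m = inject₁ (fromℕ j)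
    m≤j : toℕ m ≤ j
    m≤j = ≤-reflexive (trans (toℕ-inject₁ (fromℕ j)) (toℕ-fromℕ j))

  edge-star : ∀ n (i : Fin (suc n)) (q : C (suc n)) k →
              starAt (edge Q n i q) k ≡ isStarNo (ev (suc n) q) (toℕ i) k
  edge-star zero    F.zero q k = single-star (ev 1 q) k (proj₂ (map 1 q))
  edge-star (suc n) i      q k with notLast Q i in eq
  ... | nothing = trans (lowS-star (suc n) q k)
                    (cong (λ m → isStarNo (ev (suc (suc n)) q) m k)
                          (sym (notLast-nothing Q i eq)))
  ... | just j =
    trans (edge-star n j _ k)
      (trans (cong (λ w → isStarNo (proj₁ w) (toℕ j) k) (map-face false (suc n) last q))
        (trans (isStarNo-rep-after false (toℕ last) (toℕ j) (ev (suc (suc n)) q) k j<last)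
               (cong (λ m → isStarNo (ev (suc (suc n)) q) m k) (notLast-just Q i j eq))))
    where
    last = fromℕ (suc n)
    j<last : toℕ j < toℕ last
    j<last = subst (toℕ j <_) (sym (toℕ-fromℕ (suc n))) (toℕ<n j)

  ≈-star : ∀ {e f} → _≈_ Q e f → ∀ k → starAt e k ≡ starAt f k
  ≈-star (gen q i) k =
    trans (cong (λ w → isStar (lookup (proj₁ w) k)) (map-face false 1 i q))
      (trans (isStar-lookup-rep false (toℕ i) (ev 2 q) k)
        (sym (trans (cong (λ w → isStar (lookup (proj₁ w) k)) (map-face true 1 i q))
                    (isStar-lookup-rep true (toℕ i) (ev 2 q) k))))
  ≈-star ≈refl         k = refl
  ≈-star (≈sym p)      k = sym (≈-star p k)
  ≈-star (≈trans p p′) k = trans (≈-star p k) (≈-star p′ k)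

  inImage-nil : ∀ k → InImageU Q em [] k → ⊥
  inImage-nil k (_ , (_ , () , _) , _)

  inImage-cons : ∀ f L k {c} → starAt f k ≡ c →
                 InImageU Q em (f ∷ L) k ⇔ (c ≡ true ⊎ InImageU Q em L k)
  inImage-cons f L k refl = mk⇔
    (λ { (e , (_ , here refl , e≈f) , e⋆) →
           inj₁ (trans (sym (≈-star e≈f k)) (cong isStar e⋆))
       ; (e , (g , there g∈L , e≈g) , e⋆) → inj₂ (e , (g , g∈L , e≈g) , e⋆) })
    (λ { (inj₁ f⋆) → f , (f , here refl , ≈refl) , isStar⇒⋆ _ f⋆
       ; (inj₂ (e , (g , g∈L , e≈g) , e⋆)) → e , (g , there g∈L , e≈g) , e⋆ })

  initial-zero : ∀ k → lookup (ev 0 (HDA.initial Q)) k ≡ t0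
  initial-zero k = trans (cong (λ w → lookup (proj₁ w) k) map-init) (lookup-replicate k t0)

  pathAgrees : ∀ {n} {q : C n} (π : RootedPath Q n q) k →
               Agrees (InImageU Q em (Sπ Q π) k) (InImageU Q em (Tπ Q π) k)
                      (lookup (ev n q) k)
  pathAgrees start k = agree-start (inImage-nil k) (inImage-nil k) (initial-zero k)
  pathAgrees (up {n} {q} i π) k =
    agree-up c _ (isStarNo⇒⋆ (ev (suc n) q) (toℕ i) k)
      (inImage-cons (edge Q n i q) (Sπ Q π) k (edge-star n i q k))
      (subst (Agrees _ _) (em-face false n i q k) (pathAgrees π k))
    where c = isStarNo (ev (suc n) q) (toℕ i) k
  pathAgrees (down {n} {q} i π) k =
    subst (Agrees _ _) (sym (em-face true n i q k))
      (agree-down c _ (isStarNo⇒⋆ (ev (suc n) q) (toℕ i) k)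
        (inImage-cons (edge Q n i q) (Tπ Q π) k (edge-star n i q k))
        (pathAgrees π k))
    where c = isStarNo (ev (suc n) q) (toℕ i) k

lemma4p16 : ∀ {d : ℕ} (Q : HDA) (em : Sculpture Q d) {n : ℕ}
    {q : PrecubicalSet.Cell (HDA.precub Q) n}
    (π : RootedPath Q n q) (k : Fin d) →
    (InImageU Q em (Sπ Q π) k ⇔ (lookup (emVec {Q} em n q) k ≢ t0))
    × (InImageU Q em (Tπ Q π) k ⇔ (lookup (emVec {Q} em n q) k ≡ t1))
lemma4p16 Q em π k = pathAgrees Q em π k
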